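{- Let $A$ be a commutative ring and $s,t,v,w,P,Q,R\in A^3$. Suppose that the entries of $v\times w$ generate the unit ideal, the entries of $R$ generate the unit ideal, and $[s,t,v]$ is a unit of $A$. Assume $[s,t,R]=[v,w,R]=0$. Then there is a unit $u\in A$ such that $$[s,t,P]\,[v,w,Q]-[v,w,P]\,[s,t,Q]=u\,[P,Q,R].$$
   Context: For $x,y\in A^3$: $x\times y=(x_2y_3-x_3y_2,\;x_3y_1-x_1y_3,\;x_1y_2-x_2y_1)$, and $[x,y,z]$ is the determinant of the $3\times 3$ matrix with columns $x,y,z$. -}

module Defs where

open import Level using (Level)
open import Algebra.Bundles using (CommutativeRing)
open import Data.Product using (_×_; _,_; ∃-syntax)

module CRDefs {c ℓ : Level} (A : CommutativeRing c ℓ) where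
  open CommutativeRing A

  Vec3 : Set c
  Vec3 = Carrier × Carrier × Carrier

  cross : Vec3 → Vec3 → Vec3
  cross (x₁ , x₂ , x₃) (y₁ , y₂ , y₃) =
    ( x₂ * y₃ - x₃ * y₂
    , x₃ * y₁ - x₁ * y₃
    , x₁ * y₂ - x₂ * y₁ )

  -- [x,y,z] = determinant of the 3×3 matrix with columns x, y, z
  det3 : Vec3 → Vec3 → Vec3 → Carrier
  det3 (x₁ , x₂ , x₃) (y₁ , y₂ , y₃) (z₁ , z₂ , z₃) =
      x₁ * (y₂ * z₃ - z₂ * y₃)
    - y₁ * (x₂ * z₃ - z₂ * x₃)
    + z₁ * (x₂ * y₃ - y₂ * x₃)

  IsUnit : Carrier → Set (c Level.⊔ ℓ)
  IsUnit u = ∃[ u' ] (u * u' ≈ 1#)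

  GeneratesUnitIdeal : Vec3 → Set (c Level.⊔ ℓ)
  GeneratesUnitIdeal (x₁ , x₂ , x₃) =
    ∃[ a ] ∃[ b ] ∃[ d ] (a * x₁ + b * x₂ + d * x₃ ≈ 1#)

{-# OPTIONS --safe #-}
module Submission where

-- Write n = s × t and m = v × w, so that [s,t,P] = n · P and [v,w,P] = m · P.
-- By the Lagrange identity the left-hand side is (n × m) · (P × Q).  Both n and m
-- are orthogonal to R, and R is unimodular, r′ · R = 1; together these force
-- n × m = u R with u = (n × m) · r′, so the left-hand side is u [P,Q,R].  Taking
-- (P, Q) = (v, m′) with m′ · m = 1 instead, the left-hand side is [s,t,v], since
-- [v,w,v] = 0 and [v,w,m′] = 1; hence u [v,m′,R] = [s,t,v] and u divides a unit.

open import Defs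
open import Level using (Level)
open import Algebra.Bundles using (CommutativeRing; RawRing)
open import Algebra.Solver.Ring.AlmostCommutativeRing
  using (fromCommutativeRing; _-Raw-AlmostCommutative⟶_)
open import Data.Product using (_×_; _,_; ∃-syntax)
open import Data.Nat as ℕ using (ℕ; zero; suc)
open import Data.Nat.Properties using (+-suc)
open import Data.Integer as ℤ using (ℤ; +_; -[1+_]; _⊖_; _◃_; sign; ∣_∣)
open import Data.Integer.Properties using ([1+m]⊖[1+n]≡m⊖n)
open import Data.Sign as Sign using (Sign)
open import Data.Fin using (#_)
open import Data.Vec using ([]; _∷_)
open import Data.Maybe as Maybe using (Maybe)
open import Function using (_∘_)
open import Relation.Binary.PropositionalEquality as ≡ using (_≡_)
open import Relation.Nullary.Decidable using (dec⇒maybe)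

module RingProperties {c ℓ : Level} (A : CommutativeRing c ℓ) where
  open CommutativeRing A
  open CRDefs A
  open import Algebra.Properties.Ring ring using (-0#≈0#)
  open import Relation.Binary.Reasoning.Setoid setoid

  x-0≈x : ∀ x → x - 0# ≈ x
  x-0≈x x = trans (+-congˡ -0#≈0#) (+-identityʳ x)

  divisor-isUnit : ∀ {u a b} → u * a ≈ b → IsUnit b → IsUnit u
  divisor-isUnit {u} {a} {b} u*a≈b (b′ , b*b′≈1) = a * b′ , (begin
    u * (a * b′)   ≈⟨ *-assoc u a b′ ⟨
    u * a * b′     ≈⟨ *-congʳ u*a≈b ⟩
    b * b′         ≈⟨ b*b′≈1 ⟩
    1#             ∎)

-- The ring solver over an arbitrary commutative ring, with coefficients in ℤ
-- so that cancellation of coefficients is decided in ℤ.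
module IntegerCoefficients {c ℓ : Level} (A : CommutativeRing c ℓ) where
  open CommutativeRing A
  open RingProperties A using (x-0≈x)
  open import Algebra.Properties.Ring ring
    using (-0#≈0#; -‿distribˡ-*; -‿distribʳ-*; -‿involutive; -‿+-comm)
  open import Algebra.Properties.Semiring.Mult semiring
    using (×-homo-+; ×1-homo-*) renaming (_×_ to _×ₙ_)
  open import Algebra.Properties.CommutativeSemigroup +-commutativeSemigroup
    using (interchange)
  open import Relation.Binary.Reasoning.Setoid setoid

  fromℕ : ℕ → Carrier
  fromℕ n = n ×ₙ 1#

  fromℤ : ℤ → Carrier
  fromℤ (+ n)     = fromℕ n
  fromℤ -[1+ n ] = - fromℕ (suc n)

  signed : Sign → Carrier → Carrier
  signed Sign.+ x = x
  signed Sign.- x = - x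

  signed-cong : ∀ s {x y} → x ≈ y → signed s x ≈ signed s y
  signed-cong Sign.+ x≈y = x≈y
  signed-cong Sign.- x≈y = -‿cong x≈y

  signed-* : ∀ s t x y → signed (s Sign.* t) (x * y) ≈ signed s x * signed t y
  signed-* Sign.+ Sign.+ x y = refl
  signed-* Sign.+ Sign.- x y = -‿distribʳ-* x y
  signed-* Sign.- Sign.+ x y = -‿distribˡ-* x y
  signed-* Sign.- Sign.- x y = begin
    x * y         ≈⟨ -‿involutive (x * y) ⟨
    - - (x * y)   ≈⟨ -‿cong (-‿distribʳ-* x y) ⟩
    - (x * - y)   ≈⟨ -‿distribˡ-* x (- y) ⟩
    - x * - y     ∎

  fromℤ-◃ : ∀ s n → fromℤ (s ◃ n) ≈ signed s (fromℕ n)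
  fromℤ-◃ Sign.+ zero    = refl
  fromℤ-◃ Sign.- zero    = sym -0#≈0#
  fromℤ-◃ Sign.+ (suc n) = refl
  fromℤ-◃ Sign.- (suc n) = refl

  fromℤ≈signed-fromℕ : ∀ i → fromℤ i ≈ signed (sign i) (fromℕ ∣ i ∣)
  fromℤ≈signed-fromℕ (+ n)     = refl
  fromℤ≈signed-fromℕ -[1+ n ] = refl

  fromℤ-* : ∀ i j → fromℤ (i ℤ.* j) ≈ fromℤ i * fromℤ j
  fromℤ-* i j = begin
    fromℤ (i ℤ.* j)                                   ≈⟨ fromℤ-◃ s (∣ i ∣ ℕ.* ∣ j ∣) ⟩
    signed s (fromℕ (∣ i ∣ ℕ.* ∣ j ∣))                ≈⟨ signed-cong s (×1-homo-* ∣ i ∣ ∣ j ∣) ⟩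
    signed s (fromℕ ∣ i ∣ * fromℕ ∣ j ∣)              ≈⟨ signed-* (sign i) (sign j) _ _ ⟩
    signed (sign i) (fromℕ ∣ i ∣) * signed (sign j) (fromℕ ∣ j ∣)
      ≈⟨ *-cong (fromℤ≈signed-fromℕ i) (fromℤ≈signed-fromℕ j) ⟨
    fromℤ i * fromℤ j                                 ∎
    where s = sign i Sign.* sign j

  [1+x]-[1+y]≈x-y : ∀ x y → (1# + x) - (1# + y) ≈ x - y
  [1+x]-[1+y]≈x-y x y = begin
    (1# + x) - (1# + y)     ≈⟨ +-congˡ (-‿+-comm 1# y) ⟨
    (1# + x) + (- 1# - y)   ≈⟨ interchange 1# x (- 1#) (- y) ⟩
    (1# - 1#) + (x - y)     ≈⟨ +-congʳ (-‿inverseʳ 1#) ⟩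
    0# + (x - y)            ≈⟨ +-identityˡ (x - y) ⟩
    x - y                   ∎

  fromℤ-⊖ : ∀ m n → fromℤ (m ⊖ n) ≈ fromℕ m - fromℕ n
  fromℤ-⊖ m       zero    = sym (x-0≈x (fromℕ m))
  fromℤ-⊖ zero    (suc n) = sym (+-identityˡ _)
  fromℤ-⊖ (suc m) (suc n) = begin
    fromℤ (suc m ⊖ suc n)            ≡⟨ ≡.cong fromℤ ([1+m]⊖[1+n]≡m⊖n m n) ⟩
    fromℤ (m ⊖ n)                    ≈⟨ fromℤ-⊖ m n ⟩
    fromℕ m - fromℕ n                ≈⟨ [1+x]-[1+y]≈x-y (fromℕ m) (fromℕ n) ⟨
    fromℕ (suc m) - fromℕ (suc n)    ∎

  fromℤ-+ : ∀ i j → fromℤ (i ℤ.+ j) ≈ fromℤ i + fromℤ j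
  fromℤ-+ (+ m)     (+ n)     = ×-homo-+ 1# m n
  fromℤ-+ (+ m)     -[1+ n ] = fromℤ-⊖ m (suc n)
  fromℤ-+ -[1+ m ] (+ n)     = trans (fromℤ-⊖ n (suc m)) (+-comm _ _)
  fromℤ-+ -[1+ m ] -[1+ n ] = begin
    - fromℕ (suc (suc (m ℕ.+ n)))          ≡⟨ ≡.cong (λ k → - fromℕ (suc k)) (+-suc m n) ⟨
    - fromℕ (suc m ℕ.+ suc n)              ≈⟨ -‿cong (×-homo-+ 1# (suc m) (suc n)) ⟩
    - (fromℕ (suc m) + fromℕ (suc n))      ≈⟨ -‿+-comm _ _ ⟨
    - fromℕ (suc m) - fromℕ (suc n)        ∎

  fromℤ-neg : ∀ i → fromℤ (ℤ.- i) ≈ - fromℤ i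
  fromℤ-neg (+ zero)  = sym -0#≈0#
  fromℤ-neg (+ suc n) = refl
  fromℤ-neg -[1+ n ] = sym (-‿involutive _)

  fromℤ-homomorphism : ℤ.+-*-rawRing -Raw-AlmostCommutative⟶ fromCommutativeRing A
  fromℤ-homomorphism = record
    { ⟦_⟧    = fromℤ
    ; +-homo = fromℤ-+
    ; *-homo = fromℤ-*
    ; -‿homo = fromℤ-neg
    ; 0-homo = refl
    ; 1-homo = +-identityʳ 1#
    }

  fromℤ-≟ : ∀ i j → Maybe (fromℤ i ≈ fromℤ j)
  fromℤ-≟ i j = Maybe.map (reflexive ∘ ≡.cong fromℤ) (dec⇒maybe (i ℤ.≟ j))

  open import Algebra.Solver.Ring
    ℤ.+-*-rawRing (fromCommutativeRing A) fromℤ-homomorphism fromℤ-≟ public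

-- The operations of Defs over an arbitrary raw ring, so that they can also be
-- applied to polynomials and handed to the ring solver.
module Vec3Operations {c ℓ : Level} (R : RawRing c ℓ) where
  open RawRing R

  private
    infixl 6 _-_
    _-_ : Carrier → Carrier → Carrier
    x - y = x + - y

  Vec3 : Set c
  Vec3 = Carrier × Carrier × Carrier

  cross : Vec3 → Vec3 → Vec3
  cross (x₁ , x₂ , x₃) (y₁ , y₂ , y₃) =
    ( x₂ * y₃ - x₃ * y₂
    , x₃ * y₁ - x₁ * y₃
    , x₁ * y₂ - x₂ * y₁ )

  det3 : Vec3 → Vec3 → Vec3 → Carrier
  det3 (x₁ , x₂ , x₃) (y₁ , y₂ , y₃) (z₁ , z₂ , z₃) =
      x₁ * (y₂ * z₃ - z₂ * y₃)
    - y₁ * (x₂ * z₃ - z₂ * x₃)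
    + z₁ * (x₂ * y₃ - y₂ * x₃)

  infix 9 _·_
  _·_ : Vec3 → Vec3 → Carrier
  (x₁ , x₂ , x₃) · (y₁ , y₂ , y₃) = x₁ * y₁ + x₂ * y₂ + x₃ * y₃

module CrossProducts {c ℓ : Level} (A : CommutativeRing c ℓ) where
  open CommutativeRing A
  open CRDefs A
  open IntegerCoefficients A
  open Vec3Operations rawRing public using (_·_)
  open import Algebra.Properties.Group +-group using (x∙y⁻¹≈ε⇒x≈y)
  open import Relation.Binary.Reasoning.Setoid setoid

  private
    polynomials : ℕ → RawRing Level.zero Level.zero
    polynomials n = record
      { Carrier = Polynomial n
      ; _≈_     = _≡_
      ; _+_     = _:+_
      ; _*_     = _:*_
      ; -_      = :-_
      ; 0#      = con (+ 0)
      ; 1#      = con (+ 1)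
      }

    module ₚ = Vec3Operations (polynomials 12)

    X Y Z W : ₚ.Vec3
    X = var (# 0) , var (# 1)  , var (# 2)
    Y = var (# 3) , var (# 4)  , var (# 5)
    Z = var (# 6) , var (# 7)  , var (# 8)
    W = var (# 9) , var (# 10) , var (# 11)

    ρ : Vec3 → Vec3 → Vec3 → Vec3 → Env 12
    ρ (x₁ , x₂ , x₃) (y₁ , y₂ , y₃) (z₁ , z₂ , z₃) (w₁ , w₂ , w₃) =
      x₁ ∷ x₂ ∷ x₃ ∷ y₁ ∷ y₂ ∷ y₃ ∷ z₁ ∷ z₂ ∷ z₃ ∷ w₁ ∷ w₂ ∷ w₃ ∷ []

    𝟎 : Vec3
    𝟎 = 0# , 0# , 0#

  ·-comm : ∀ x y → x · y ≈ y · x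
  ·-comm x y = prove (ρ x y 𝟎 𝟎) (X ₚ.· Y) (Y ₚ.· X) refl

  det3≈cross-· : ∀ x y z → det3 x y z ≈ cross x y · z
  det3≈cross-· x y z = prove (ρ x y z 𝟎) (ₚ.det3 X Y Z) (ₚ.cross X Y ₚ.· Z) refl

  det3≈·-cross : ∀ x y z → det3 x y z ≈ z · cross x y
  det3≈·-cross x y z = prove (ρ x y z 𝟎) (ₚ.det3 X Y Z) (Z ₚ.· ₚ.cross X Y) refl

  det3[x,y,x]≈0 : ∀ x y → det3 x y x ≈ 0#
  det3[x,y,x]≈0 x y = prove (ρ x y 𝟎 𝟎) (ₚ.det3 X Y X) (con (+ 0)) refl

  cross-·-interchange : ∀ x y z → cross x y · z ≈ x · cross y z
  cross-·-interchange x y z =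
    prove (ρ x y z 𝟎) (ₚ.cross X Y ₚ.· Z) (X ₚ.· ₚ.cross Y Z) refl

  lagrange : ∀ a b p q → (a · p) * (b · q) - (b · p) * (a · q) ≈ cross a b · cross p q
  lagrange a b p q = prove (ρ a b p q)
    ((X ₚ.· Z) :* (Y ₚ.· W) :- (Y ₚ.· Z) :* (X ₚ.· W)) (ₚ.cross X Y ₚ.· ₚ.cross Z W) refl

  det3-lagrange : ∀ s t v w p q →
    det3 s t p * det3 v w q - det3 v w p * det3 s t q ≈ cross (cross s t) (cross v w) · cross p q
  det3-lagrange s t v w p q = begin
    det3 s t p * det3 v w q - det3 v w p * det3 s t q
      ≈⟨ +-cong (*-cong (det3≈cross-· s t p) (det3≈cross-· v w q))
                (-‿cong (*-cong (det3≈cross-· v w p) (det3≈cross-· s t q))) ⟩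
    (cross s t · p) * (cross v w · q) - (cross v w · p) * (cross s t · q)
      ≈⟨ lagrange (cross s t) (cross v w) p q ⟩
    cross (cross s t) (cross v w) · cross p q
      ∎

  cross-proportional : ∀ {r′ r n m} → r′ · r ≈ 1# → n · r ≈ 0# → m · r ≈ 0# →
                       ∀ y → cross n m · y ≈ (cross n m · r′) * (r · y)
  cross-proportional {r′} {r} {n} {m} r′·r≈1 n·r≈0 m·r≈0 y = begin
    x · y                ≈⟨ *-identityʳ (x · y) ⟨
    (x · y) * 1#         ≈⟨ *-congˡ (trans (·-comm r r′) r′·r≈1) ⟨
    (x · y) * (r · r′)   ≈⟨ x∙y⁻¹≈ε⇒x≈y _ _ vanishes ⟩
    (r · y) * (x · r′)   ≈⟨ *-comm (r · y) (x · r′) ⟩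
    (x · r′) * (r · y)   ∎
    where
    x = cross n m
    z = cross y r′
    vanishes : (x · y) * (r · r′) - (r · y) * (x · r′) ≈ 0#
    vanishes = begin
      (x · y) * (r · r′) - (r · y) * (x · r′) ≈⟨ lagrange x r y r′ ⟩
      cross x r · z                           ≈⟨ cross-·-interchange x r z ⟩
      x · cross r z                           ≈⟨ lagrange n m r z ⟨
      (n · r) * (m · z) - (m · r) * (n · z)   ≈⟨ +-cong (*-congʳ n·r≈0) (-‿cong (*-congʳ m·r≈0)) ⟩
      0# * (m · z) - 0# * (n · z)             ≈⟨ +-cong (zeroˡ (m · z)) (-‿cong (zeroˡ (n · z))) ⟩
      0# - 0#                                 ≈⟨ -‿inverseʳ 0# ⟩
      0#                                      ∎

proposition3p5 : {c ℓ : Level} (A : CommutativeRing c ℓ) →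
    let open CommutativeRing A
        open CRDefs A
    in (s t v w P Q R : Vec3) →
       GeneratesUnitIdeal (cross v w) →
       GeneratesUnitIdeal R →
       IsUnit (det3 s t v) →
       det3 s t R ≈ 0# →
       det3 v w R ≈ 0# →
       ∃[ u ] (IsUnit u ×
         (det3 s t P * det3 v w Q - det3 v w P * det3 s t Q ≈ u * det3 P Q R))
proposition3p5 A s t v w P Q R (m₁ , m₂ , m₃ , m′·m≈1) (r₁ , r₂ , r₃ , r′·R≈1)
               [s,t,v]-unit [s,t,R]≈0 [v,w,R]≈0 =
  u , divisor-isUnit u*[R,v,m′]≈[s,t,v] [s,t,v]-unit , (begin
    det3 s t P * det3 v w Q - det3 v w P * det3 s t Q   ≈⟨ det3-lagrange s t v w P Q ⟩
    x · cross P Q                                       ≈⟨ proportional (cross P Q) ⟩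
    u * (R · cross P Q)                                 ≈⟨ *-congˡ (det3≈·-cross P Q R) ⟨
    u * det3 P Q R                                      ∎)
  where
  open CommutativeRing A
  open CRDefs A
  open RingProperties A
  open CrossProducts A
  open import Relation.Binary.Reasoning.Setoid setoid

  m′ r′ x : Vec3
  m′ = m₁ , m₂ , m₃
  r′ = r₁ , r₂ , r₃
  x  = cross (cross s t) (cross v w)

  u : Carrier
  u = x · r′

  proportional : ∀ y → x · y ≈ u * (R · y)
  proportional = cross-proportional r′·R≈1
    (trans (sym (det3≈cross-· s t R)) [s,t,R]≈0)
    (trans (sym (det3≈cross-· v w R)) [v,w,R]≈0)

  u*[R,v,m′]≈[s,t,v] : u * (R · cross v m′) ≈ det3 s t v
  u*[R,v,m′]≈[s,t,v] = begin
    u * (R · cross v m′)                                  ≈⟨ proportional (cross v m′) ⟨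
    x · cross v m′                                        ≈⟨ det3-lagrange s t v w v m′ ⟨
    det3 s t v * det3 v w m′ - det3 v w v * det3 s t m′
      ≈⟨ +-cong (*-congˡ (trans (det3≈·-cross v w m′) m′·m≈1))
                (-‿cong (*-congʳ (det3[x,y,x]≈0 v w))) ⟩
    det3 s t v * 1# - 0# * det3 s t m′                    ≈⟨ +-cong (*-identityʳ _) (-‿cong (zeroˡ _)) ⟩
    det3 s t v - 0#                                       ≈⟨ x-0≈x (det3 s t v) ⟩
    det3 s t v                                            ∎
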